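{- Let $S$ be a minimal dominating set of a graph $H$, and let $D$ be a minimal dominating set of a graph $G$ such that $c(D) \neq \emptyset$. Then for every $u \in c(D)$, the set $(\{u\} \times S) \cup \big( (D-\{u\}) \times V(H)\big)$ is a dominating set of $G \,\square\, H$. If, in addition, $c(D)=\{u\}$, then $(\{u\} \times S) \cup \big( (D-\{u\}) \times V(H)\big)$ is a minimal dominating set of $G \,\square\, H$.
   Context: All graphs are finite, simple and undirected, of order at least $2$. A dominating set of $X$ is a set $D$ of vertices such that every vertex is in $D$ or adjacent to a vertex of $D$; minimal if no proper subset dominates. For $u\in A\subseteq V(X)$ the private neighborhood is $\mathrm{pn}[u,A]=\{x\in V(X): N[x]\cap A=\{u\}\}$. For a dominating set $D$ of $G$, $c(D)=\{x\in D: \mathrm{pn}[x,D]=\{x\}\}$. The Cartesian product $G\,\square\, H$ has vertex set $V(G)\times V(H)$, with $(g_1,h_1)\sim(g_2,h_2)$ iff either $g_1=g_2$ and $h_1h_2\in E(H)$, or $h_1=h_2$ and $g_1g_2\in E(G)$. -}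

module Defs where

open import Data.Nat using (ℕ; _≥_)
open import Data.Fin using (Fin)
open import Data.Product using (_×_; _,_; ∃; ∃-syntax)
open import Data.Sum using (_⊎_)
open import Relation.Nullary using (¬_; Dec)
open import Relation.Binary.PropositionalEquality using (_≡_)
open import Function.Bundles using (_↔_)

record RawGraph : Set₁ where
  field
    V   : Set
    Adj : V → V → Set

record Graph : Set₁ where
  field
    raw     : RawGraph
  open RawGraph raw public
  field
    order   : ℕ
    enum    : Fin order ↔ V
    order≥2 : order ≥ 2
    Adj?    : (x y : V) → Dec (Adj x y)
    irrefl  : (x : V) → ¬ Adj x x
    sym     : (x y : V) → Adj x y → Adj y x

_□_ : Graph → Graph → RawGraph
G □ H = record
  { V   = G.V × H.V
  ; Adj = λ { (g₁ , h₁) (g₂ , h₂) →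
              ((g₁ ≡ g₂) × H.Adj h₁ h₂) ⊎ ((h₁ ≡ h₂) × G.Adj g₁ g₂) }
  }
  where
  module G = Graph G
  module H = Graph H

VSet : RawGraph → Set₁
VSet X = RawGraph.V X → Set

module _ (X : RawGraph) where
  open RawGraph X

  InN : V → V → Set
  InN x y = (y ≡ x) ⊎ Adj x y

  Dominating : VSet X → Set
  Dominating D = (x : V) → D x ⊎ (∃[ y ] (D y × Adj x y))

  Subset : VSet X → VSet X → Set
  Subset A B = (x : V) → A x → B x

  ProperSubset : VSet X → VSet X → Set
  ProperSubset A B = Subset A B × (∃[ x ] (B x × ¬ A x))

  MinimalDominating : VSet X → Set₁
  MinimalDominating D =
    Dominating D × ((T : VSet X) → ProperSubset T D → ¬ Dominating T)

  -- x ∈ pn[u,A]  iff  N[x] ∩ A = {u}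
  InPn : V → VSet X → V → Set
  InPn u A x = (InN x u × A u) × ((y : V) → InN x y → A y → y ≡ u)

  -- x ∈ c(D)  iff  x ∈ D and pn[x,D] = {x}
  InC : VSet X → V → Set
  InC D x = D x × (InPn x D x × ((y : V) → InPn x D y → y ≡ x))

-- ({u} × S) ∪ ((D - {u}) × V(H)); the second factor V(H) imposes no condition on h
ProdSet : (G H : Graph) → VSet (Graph.raw G) → Graph.V G → VSet (Graph.raw H)
        → VSet (G □ H)
ProdSet G H D u S (g , h) = ((g ≡ u) × S h) ⊎ (D g × ¬ (g ≡ u))

-- Write P for the product set.  If N[g] ∩ D contains a vertex z ≠ u, then (g, h) is dominated
-- inside the layers (D − {u}) × V(H); otherwise g is a private neighbour of u, hence g = u, and
-- {u} × S dominates the u-layer as S dominates H.  For minimality, a dominating T ⊊ P misses some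
-- (g, h) ∈ P.  If g = u, the layer {h : (u, h) ∈ T} is a dominating proper subset of S, because u
-- has no neighbour in D.  If g ≠ u, then g ∉ c(D), so g has a private neighbour y ≠ g; as y ∉ D,
-- the only possible dominator of (y, h) within D × V(H) is (g, h), which is missing from T.
module Submission where

open import Defs
import Data.Fin as Fin
open import Data.Fin.Properties using (any?)
open import Data.Product using (_×_; _,_; proj₁; proj₂; ∃; ∃-syntax)
open import Data.Sum using (_⊎_; inj₁; inj₂)
import Data.Sum as Sum
open import Data.Empty using (⊥; ⊥-elim)
open import Function using (_∘_)
open import Function.Bundles using (Inverse)
open import Function.Properties.Inverse using (↔-sym; ↔⇒↣)
open import Relation.Nullary using (¬_; Dec; yes; no)
open import Relation.Nullary.Decidable
  using (map′; via-injection; ¬?; _×-dec_; _⊎-dec_; decidable-stable)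
open import Relation.Unary using (Decidable)
open import Relation.Binary.Definitions using (DecidableEquality)
open import Relation.Binary.PropositionalEquality using (_≡_; _≢_; refl; sym; subst)

_without_ : {A : Set} → (A → Set) → A → A → Set
(D without w) x = D x × x ≢ w

module _ (X : RawGraph) where
  open RawGraph X

  DominatedBy : VSet X → V → Set
  DominatedBy D x = D x ⊎ ∃[ y ] (D y × Adj x y)

  OtherDominator : VSet X → V → V → Set
  OtherDominator D x w = ∃[ z ] (InN X x z × D z × z ≢ w)

  DominatedOnlyBy : VSet X → V → V → Set
  DominatedOnlyBy D x w = (z : V) → InN X x z → D z → z ≡ w

module _ (X : RawGraph) where
  open RawGraph X

  dominator : {D : VSet X} → Dominating X D → (x : V) → ∃[ z ] (InN X x z × D z)
  dominator domD x with domD x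
  ... | inj₁ dx            = x , inj₁ refl , dx
  ... | inj₂ (y , dy , x~y) = y , inj₂ x~y , dy

  otherDominator⇒dominatedBy-without : {D : VSet X} {x w : V} →
    OtherDominator X D x w → DominatedBy X (D without w) x
  otherDominator⇒dominatedBy-without (z , inj₁ refl , dz , z≢w) = inj₁ (dz , z≢w)
  otherDominator⇒dominatedBy-without (z , inj₂ x~z , dz , z≢w) = inj₂ (z , (dz , z≢w) , x~z)

  dominatedOnlyBy⇒privateNeighbour : {D : VSet X} {x w : V} →
    Dominating X D → DominatedOnlyBy X D x w → InPn X w D x
  dominatedOnlyBy⇒privateNeighbour {D} {x} domD only
    with z , z∈N[x] , dz ← dominator domD x
    with refl ← only z z∈N[x] dz
    = (z∈N[x] , dz) , only

  module _ {D : VSet X} (domD : Dominating X D) where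

    chosenDominator : V → V
    chosenDominator x = proj₁ (dominator domD x)

    ChosenDominators : VSet X
    ChosenDominators y = ∃[ x ] chosenDominator x ≡ y

    chosenDominators⊆ : Subset X ChosenDominators D
    chosenDominators⊆ _ (x , refl) = proj₂ (proj₂ (dominator domD x))

    chosenDominators-dominating : Dominating X ChosenDominators
    chosenDominators-dominating x with proj₁ (proj₂ (dominator domD x))
    ... | inj₁ chosen≡x = inj₁ (x , chosen≡x)
    ... | inj₂ x~chosen = inj₂ (chosenDominator x , (x , refl) , x~chosen)

  privateNeighbour≢⇒outside : {D : VSet X} {w y : V} → InPn X w D y → y ≢ w → ¬ D y
  privateNeighbour≢⇒outside (_ , only) y≢w dy = y≢w (only _ (inj₁ refl) dy)

module FiniteGraph (G : Graph) where
  open Graph G hiding (sym)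

  _≟_ : DecidableEquality V
  _≟_ = via-injection (↔⇒↣ (↔-sym enum)) Fin._≟_

  ∃? : {P : V → Set} → Decidable P → Dec (∃ P)
  ∃? {P} P? = map′ (λ (i , p) → to i , p)
                   (λ (v , p) → from v , subst P (sym (strictlyInverseˡ v)) p)
                   (any? (P? ∘ to))
    where open Inverse enum

  InN? : (x y : V) → Dec (InN raw x y)
  InN? x y = (y ≟ x) ⊎-dec Adj? x y

  module _ {D : VSet raw} where

    -- The chosen dominators form a dominating subset of D with decidable membership,
    -- so a minimal D coincides with it.
    minimalDominating⇒decidable : MinimalDominating raw D → Decidable D
    minimalDominating⇒decidable (domD , minD) y with ∃? (λ x → chosenDominator raw domD x ≟ y)
    ... | yes chosen  = yes (chosenDominators⊆ raw domD y chosen)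
    ... | no unchosen = no λ dy →
      minD (ChosenDominators raw domD) (chosenDominators⊆ raw domD , y , dy , unchosen)
           (chosenDominators-dominating raw domD)

    module _ (D? : Decidable D) where

      otherDominator? : (x w : V) → Dec (OtherDominator raw D x w)
      otherDominator? x w = ∃? λ z → InN? x z ×-dec D? z ×-dec ¬? (z ≟ w)

      ¬otherDominator⇒dominatedOnlyBy : {x w : V} →
        ¬ OtherDominator raw D x w → DominatedOnlyBy raw D x w
      ¬otherDominator⇒dominatedOnlyBy {w = w} ¬other z z∈N[x] dz =
        decidable-stable (z ≟ w) λ z≢w → ¬other (z , z∈N[x] , dz , z≢w)

      dominatedOnlyBy? : (x w : V) → Dec (DominatedOnlyBy raw D x w)
      dominatedOnlyBy? x w with otherDominator? x w
      ... | yes (z , z∈N[x] , dz , z≢w) = no λ only → z≢w (only z z∈N[x] dz)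
      ... | no ¬other                   = yes (¬otherDominator⇒dominatedOnlyBy ¬other)

      privateNeighbour? : (w x : V) → Dec (InPn raw w D x)
      privateNeighbour? w x = (InN? x w ×-dec D? w) ×-dec dominatedOnlyBy? x w

    module _ (mdD : MinimalDominating raw D) where
      private
        D? : Decidable D
        D? = minimalDominating⇒decidable mdD

      privateNeighbour : {g : V} → D g → ∃[ x ] InPn raw g D x
      privateNeighbour {g} dg with ∃? (¬? ∘ λ x → otherDominator? D? x g)
      ... | yes (x , ¬other) =
        x , dominatedOnlyBy⇒privateNeighbour raw (proj₁ mdD)
              (¬otherDominator⇒dominatedOnlyBy D? ¬other)
      ... | no noPrivateNeighbour = ⊥-elim (proj₂ mdD (D without g) without⊊D without-dominating)
        where
        without⊊D : ProperSubset raw (D without g) D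
        without⊊D = (λ _ → proj₁) , g , dg , λ (_ , g≢g) → g≢g refl

        without-dominating : Dominating raw (D without g)
        without-dominating x = otherDominator⇒dominatedBy-without raw
          (decidable-stable (otherDominator? D? x g) λ ¬other → noPrivateNeighbour (x , ¬other))

      nonCritical⇒privateNeighbour≢ : {g : V} → D g → ¬ InC raw D g → ∃[ y ] (y ≢ g × InPn raw g D y)
      nonCritical⇒privateNeighbour≢ {g} dg ¬critical
        with ∃? (λ y → ¬? (y ≟ g) ×-dec privateNeighbour? D? g y)
      ... | yes found = found
      ... | no none   = ⊥-elim (¬critical (dg , subst (InPn raw g D) (onlySelf x pn) pn , onlySelf))
        where
        x  = proj₁ (privateNeighbour dg)
        pn = proj₂ (privateNeighbour dg)

        onlySelf : (y : V) → InPn raw g D y → y ≡ g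
        onlySelf y pny = decidable-stable (y ≟ g) λ y≢g → none (y , y≢g , pny)

selfPrivate⇒¬adjacentInside : (G : Graph) {D : VSet (Graph.raw G)} {u z : Graph.V G} →
  InPn (Graph.raw G) u D u → D z → ¬ Graph.Adj G u z
selfPrivate⇒¬adjacentInside G {u = u} (_ , only) dz u~z =
  Graph.irrefl G u (subst (Graph.Adj G u) (only _ (inj₂ u~z) dz) u~z)

module _ (G H : Graph) {D : VSet (Graph.raw G)} {S : VSet (Graph.raw H)} {u : Graph.V G} where
  private
    module G = Graph G
    module H = Graph H
  open FiniteGraph G

  ProdSet⇒firstInside : D u → {g : G.V} {h : H.V} → ProdSet G H D u S (g , h) → D g
  ProdSet⇒firstInside du (inj₁ (refl , _)) = du
  ProdSet⇒firstInside du (inj₂ (dg , _))   = dg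

  ProdSet-dominating : Dominating H.raw S → Dominating G.raw D → Decidable D →
    ((y : G.V) → InPn G.raw u D y → y ≡ u) → Dominating (G □ H) (ProdSet G H D u S)
  ProdSet-dominating domS domD D? pn⊆u (g , h) with otherDominator? D? g u
  ... | yes other = Sum.map inj₂ (λ (y , dy , g~y) → (y , h) , inj₂ dy , inj₂ (refl , g~y))
                            (otherDominator⇒dominatedBy-without G.raw other)
  ... | no ¬other
    with refl ← pn⊆u g (dominatedOnlyBy⇒privateNeighbour G.raw domD
                          (¬otherDominator⇒dominatedOnlyBy D? ¬other))
    = Sum.map (λ sh → inj₁ (refl , sh))
              (λ (h′ , sh′ , h~h′) → (u , h′) , inj₁ (refl , sh′) , inj₁ (refl , h~h′))
              (domS h)

  module _ {T : VSet (G □ H)} (T⇒firstInside : {g : G.V} {h : H.V} → T (g , h) → D g) where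

    layer-dominating : InPn G.raw u D u → Dominating (G □ H) T → Dominating H.raw (λ h → T (u , h))
    layer-dominating selfPrivate domT h with domT (u , h)
    ... | inj₁ t                                 = inj₁ t
    ... | inj₂ ((_ , h′) , t , inj₁ (refl , h~h′)) = inj₂ (h′ , t , h~h′)
    ... | inj₂ ((_ , _) , t , inj₂ (refl , u~g)) =
      ⊥-elim (selfPrivate⇒¬adjacentInside G selfPrivate (T⇒firstInside t) u~g)

    privateNeighbour-undominated : {g y : G.V} {h : H.V} → ¬ T (g , h) → y ≢ g →
      InPn G.raw g D y → ¬ Dominating (G □ H) T
    privateNeighbour-undominated {y = y} {h} ∉T y≢g pn@(_ , only) domT with domT (y , h)
    ... | inj₁ t                                  = privateNeighbour≢⇒outside G.raw pn y≢g (T⇒firstInside t)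
    ... | inj₂ (_ , t , inj₁ (refl , _))          = privateNeighbour≢⇒outside G.raw pn y≢g (T⇒firstInside t)
    ... | inj₂ ((y′ , _) , t , inj₂ (refl , y~y′))
      with refl ← only y′ (inj₂ y~y′) (T⇒firstInside t) = ∉T t

  ProdSet-irredundant : MinimalDominating H.raw S → MinimalDominating G.raw D →
    InC G.raw D u → ((x : G.V) → InC G.raw D x → x ≡ u) →
    (T : VSet (G □ H)) → ProperSubset (G □ H) T (ProdSet G H D u S) → ¬ Dominating (G □ H) T
  ProdSet-irredundant (_ , minS) mdD (du , selfPrivate , _) uniq T (T⊆P , _ , p , ∉T) domT =
    missingFromT p ∉T
    where
    T⇒firstInside : {g : G.V} {h : H.V} → T (g , h) → D g
    T⇒firstInside t = ProdSet⇒firstInside du (T⊆P _ t)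

    layer⊆S : Subset H.raw (λ h → T (u , h)) S
    layer⊆S h t with T⊆P (u , h) t
    ... | inj₁ (_ , sh)  = sh
    ... | inj₂ (_ , u≢u) = ⊥-elim (u≢u refl)

    missingFromT : {g : G.V} {h : H.V} → ProdSet G H D u S (g , h) → ¬ T (g , h) → ⊥
    missingFromT {h = h} (inj₁ (refl , sh)) ∉T =
      minS (λ h → T (u , h)) (layer⊆S , h , sh , ∉T) (layer-dominating T⇒firstInside selfPrivate domT)
    missingFromT {g} (inj₂ (dg , g≢u)) ∉T
      with y , y≢g , pn ← nonCritical⇒privateNeighbour≢ mdD dg (g≢u ∘ uniq g)
      = privateNeighbour-undominated T⇒firstInside ∉T y≢g pn domT

lemma5 : (G H : Graph) (S : VSet (Graph.raw H)) (D : VSet (Graph.raw G))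
    → MinimalDominating (Graph.raw H) S
    → MinimalDominating (Graph.raw G) D
    → ∃[ x ] InC (Graph.raw G) D x
    → ((u : Graph.V G) → InC (Graph.raw G) D u
        → Dominating (G □ H) (ProdSet G H D u S))
      × ((u : Graph.V G) → ((x : Graph.V G) → InC (Graph.raw G) D x → x ≡ u)
        → InC (Graph.raw G) D u
        → MinimalDominating (G □ H) (ProdSet G H D u S))
lemma5 G H S D mdS mdD _ =
  dominating , λ u uniq cu → dominating u cu , ProdSet-irredundant G H mdS mdD cu uniq
  where
  open FiniteGraph G using (minimalDominating⇒decidable)

  dominating : (u : Graph.V G) → InC (Graph.raw G) D u → Dominating (G □ H) (ProdSet G H D u S)
  dominating u (_ , _ , pn⊆u) =
    ProdSet-dominating G H (proj₁ mdS) (proj₁ mdD) (minimalDominating⇒decidable mdD) pn⊆u
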